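{- Let $\mathcal{U}$ be a set of strongly meaningless terms. If $t\leadsto_{N_\mathcal{U}} s$, then $s$ is in $\beta\bot_\mathcal{U}$-normal form.
   Context: Infinitary lambda terms $\Lambda^\infty$ are the finite and infinite terms generated coinductively by $\Lambda^\infty ::= C \mid V \mid \Lambda^\infty\Lambda^\infty \mid \lambda V.\Lambda^\infty$, where $V$ is an infinite set of variables and $C$ a set of constants disjoint from $V$ containing a distinguished constant $\bot$; atoms are variables or constants; terms are taken modulo renaming of bound variables, $s[t/x]$ is capture-avoiding substitution. For a relation $R$, its compatible closure $\to_R$ is the least relation containing $R$ closed under $s\to_R s'\Rightarrow st\to_R s't,\ ts\to_R ts',\ \lambda x.s\to_R\lambda x.s'$; a term is in $R$-normal form if it has no $\to_R$-successor. $\to_\beta$ is the compatible closure of $R_\beta=\{((\lambda x.s)t,s[t/x])\}$, $\to^*_\beta$ its reflexive-transitive closure, and $\to^\infty_\beta$ is defined coinductively: $s\to^\infty_\beta a$ if $s\to^*_\beta a$ ($a$ an atom); $s\to^\infty_\beta t_1't_2'$ if $s\to^*_\beta t_1t_2$ and $t_i\to^\infty_\beta t_i'$; $s\to^\infty_\beta\lambda x.r'$ if $s\to^*_\beta\lambda x.r$ and $r\to^\infty_\beta r'$. Weak head reduction $\to_w$: $(\lambda x.s)t\to_w s[t/x]$, and $st\to_w s't$ if $s\to_w s'$. A term $t$ is in root normal form (rnf) if $t\equiv a$ with $a\not\equiv\bot$ an atom, or $t\equiv\lambda x.t'$, or $t\equiv t_1t_2$ with no $s$ such that $t_1\to^*_\beta\lambda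 x.s$; $\mathcal{R}$ is the set of root-active terms, i.e. $t$ with no $t'$ in rnf such that $t\to^\infty_\beta t'$. For $t\notin\mathcal{R}$, $\mathrm{crnf}(t)$ is the rnf reached by the shortest weak head reduction $t\to^*_w s$ with $s$ in rnf (it exists and is unique). The parallel closure $\Rightarrow_R$ of a relation $R$ is coinductively: $s\Rightarrow_R t$ if $(s,t)\in R$; $a\Rightarrow_R a$; $s_1s_2\Rightarrow_R t_1t_2$ if $s_i\Rightarrow_R t_i$; $\lambda x.s\Rightarrow_R\lambda x.s'$ if $s\Rightarrow_R s'$; $\sim_\mathcal{U}$ is the parallel closure of $\mathcal{U}\times\mathcal{U}$. $\mathcal{U}$ is meaningless if: (closure) $t\in\mathcal{U}$, $t\to^\infty_\beta s\Rightarrow s\in\mathcal{U}$; (substitution) $t\in\mathcal{U}\Rightarrow t[s/x]\in\mathcal{U}$; (overlap) $\lambda x.s\in\mathcal{U}\Rightarrow(\lambda x.s)t\in\mathcal{U}$; (root-activeness) $\mathcal{R}\subseteq\mathcal{U}$; (indiscernibility) $t\in\mathcal{U}$, $t\sim_\mathcal{U}s\Rightarrow s\in\mathcal{U}$; strongly meaningless if also (expansion) $t\in\mathcal{U}$, $s\to^\infty_\beta t\Rightarrow s\in\mathcal{U}$. $\beta\bot_\mathcal{U}$-normal form means normal form for $R_\beta\cup\{(t,\bot)\mid t\in\mathcal{U},t\not\equiv\bot\}$. $\leadsto_{N_\mathcal{U}}$ is defined coinductively by: $t\leadsto_{N_\mathcal{U}}\bot$ if $t\in\mathcal{U}$; $t\leadsto_{N_\mathcal{U}}a$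 if $t\notin\mathcal{U}$ and $\mathrm{crnf}(t)\equiv a$; $t\leadsto_{N_\mathcal{U}}s_1s_2$ if $t\notin\mathcal{U}$, $\mathrm{crnf}(t)\equiv t_1t_2$, $t_i\leadsto_{N_\mathcal{U}}s_i$; $t\leadsto_{N_\mathcal{U}}\lambda x.s$ if $t\notin\mathcal{U}$, $\mathrm{crnf}(t)\equiv\lambda x.t'$, $t'\leadsto_{N_\mathcal{U}}s$. -}

-- * Variables are de Bruijn indices (ℕ); hence terms modulo renaming of bound
--   variables are literally the de Bruijn trees.
-- * A (finite or infinite) term is a labelled tree, represented by its
--   labelling function  List Dir → Label  (the label at each position).
--   Positions that are not reachable (below a leaf, or a B-child of an
--   application, ...) are junk; equality of terms _≈_ compares labels on the
--   reachable positions only.  Every relation below is defined up to _≈_.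
-- * Coinductive definitions (→∞β, parallel closure, ⇝_{N_U}) are rendered
--   as greatest fixed points: "there is a relation that is a post-fixed point
--   of the defining clauses and relates the two terms".
module Defs where

open import Data.Nat using (ℕ; zero; suc; _<_)
open import Data.Nat.Properties using (_≟_)
open import Data.List using (List; []; _∷_)
open import Data.Product using (Σ; _×_; _,_)
open import Data.Sum using (_⊎_)
open import Relation.Binary.PropositionalEquality using (_≡_)
open import Relation.Nullary using (¬_; yes; no)

-- directions: left/right child of an application, body of an abstraction
data Dir : Set where
  L R B : Dir

module Lam (C : Set) (bot : C) where

  data Label : Set where
    con : C → Label
    var : ℕ → Label
    app : Label
    lam : Label

  Term : Set
  Term = List Dir → Label

  sub : Term → Dir → Term
  sub t d p = t (d ∷ p)

  data Reach (t : Term) : List Dir → Set where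
    here : Reach t []
    left : ∀ {p} → t [] ≡ app → Reach (sub t L) p → Reach t (L ∷ p)
    right : ∀ {p} → t [] ≡ app → Reach (sub t R) p → Reach t (R ∷ p)
    body : ∀ {p} → t [] ≡ lam → Reach (sub t B) p → Reach t (B ∷ p)

  _≈_ : Term → Term → Set
  s ≈ t = ∀ p → Reach s p → s p ≡ t p

  infix 4 _≈_

  ‵_ : C → Term
  (‵ c) _ = con c

  v_ : ℕ → Term
  (v n) _ = var n

  _·_ : Term → Term → Term
  (a · b) [] = app
  (a · b) (L ∷ p) = a p
  (a · b) (R ∷ p) = b p
  (a · b) (B ∷ p) = app          -- junk (unreachable)

  ƛ_ : Term → Term
  (ƛ a) [] = lam
  (ƛ a) (B ∷ p) = a p
  (ƛ a) (L ∷ p) = lam            -- junk (unreachable)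
  (ƛ a) (R ∷ p) = lam            -- junk (unreachable)

  infixl 7 _·_
  infix 6 ƛ_
  infix 8 v_ ‵_

  ext : (ℕ → ℕ) → ℕ → ℕ
  ext ρ zero = zero
  ext ρ (suc n) = suc (ρ n)

  renameL : (ℕ → ℕ) → Label → Label
  renameL ρ (var n) = var (ρ n)
  renameL ρ l = l

  rename : (ℕ → ℕ) → Term → Term
  rename ρ t [] = renameL ρ (t [])
  rename ρ t (d ∷ p) with t []
  ... | lam = rename (ext ρ) (sub t d) p
  ... | _ = rename ρ (sub t d) p

  exts : (ℕ → Term) → ℕ → Term
  exts σ zero = v zero
  exts σ (suc n) = rename suc (σ n)

  subst : (ℕ → Term) → Term → Term
  subst σ t p with t []
  subst σ t p | var n = σ n p
  subst σ t [] | l = l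
  subst σ t (d ∷ p) | lam = subst (exts σ) (sub t d) p
  subst σ t (d ∷ p) | _ = subst σ (sub t d) p

  _[_/_] : Term → Term → ℕ → Term
  t [ s / x ] = subst σ t
    where
    σ : ℕ → Term
    σ y with y ≟ x
    ... | yes _ = s
    ... | no _ = v y

  -- s [ t ]β : the contractum of (λ.s) t
  -- (index 0 replaced by t, the other free indices shifted down by one)
  _[_]β : Term → Term → Term
  s [ t ]β = subst σ s
    where
    σ : ℕ → Term
    σ zero = t
    σ (suc n) = v n

  Rel : Set₁
  Rel = Term → Term → Set

  Atom : Term → Set
  Atom t = (Σ C λ c → t ≈ ‵ c) ⊎ (Σ ℕ λ n → t ≈ v n)

  data Compat (Q : Rel) : Rel where
    root : ∀ {u w} → Q u w → Compat Q u w
    appL : ∀ {u w a a′ b} → u ≈ a · b → Compat Q a a′ → w ≈ a′ · b → Compat Q u w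
    appR : ∀ {u w a b b′} → u ≈ a · b → Compat Q b b′ → w ≈ a · b′ → Compat Q u w
    lamC : ∀ {u w a a′} → u ≈ ƛ a → Compat Q a a′ → w ≈ ƛ a′ → Compat Q u w

  NormalForm : Rel → Term → Set
  NormalForm Q t = ∀ t′ → ¬ Compat Q t t′

  Rβ : Rel
  Rβ u w = Σ Term λ s → Σ Term λ t → u ≈ (ƛ s) · t × w ≈ s [ t ]β

  _→β_ : Rel
  _→β_ = Compat Rβ

  data Star (Q : Rel) : Rel where
    ε : ∀ {u w} → u ≈ w → Star Q u w
    _◅_ : ∀ {u m w} → Q u m → Star Q m w → Star Q u w

  _→*β_ : Rel
  _→*β_ = Star _→β_

  infix 4 _→β_ _→*β_ _→∞β_ _→w_

  -- one unfolding of the coinductive definition of →∞β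
  InfStep : Rel → Rel
  InfStep Q s t =
      (Atom t × s →*β t)
    ⊎ (Σ Term λ t₁ → Σ Term λ t₂ → Σ Term λ t₁′ → Σ Term λ t₂′ →
         t ≈ t₁′ · t₂′ × s →*β t₁ · t₂ × Q t₁ t₁′ × Q t₂ t₂′)
    ⊎ (Σ Term λ r → Σ Term λ r′ → t ≈ ƛ r′ × s →*β ƛ r × Q r r′)

  _→∞β_ : Term → Term → Set₁
  s →∞β t = Σ Rel λ Q → (∀ a b → Q a b → InfStep Q a b) × Q s t

  data _→w_ : Rel where
    root : ∀ {u w} → Rβ u w → u →w w
    appL : ∀ {u w a a′ b} → u ≈ a · b → a →w a′ → w ≈ a′ · b → u →w w

  data _→w[_]_ : Term → ℕ → Term → Set where
    ε : ∀ {u w} → u ≈ w → u →w[ zero ] w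
    _◅_ : ∀ {u m w n} → u →w m → m →w[ n ] w → u →w[ suc n ] w

  RNF : Term → Set
  RNF t = (Atom t × ¬ (t ≈ ‵ bot))
        ⊎ (Σ Term λ t′ → t ≈ ƛ t′)
        ⊎ (Σ Term λ t₁ → Σ Term λ t₂ → t ≈ t₁ · t₂ × ¬ (Σ Term λ s → t₁ →*β ƛ s))

  RootActive : Term → Set₁
  RootActive t = ¬ (Σ Term λ t′ → RNF t′ × t →∞β t′)

  Crnf : Term → Term → Set
  Crnf t s = Σ ℕ λ n → t →w[ n ] s × RNF s ×
             (∀ m → m < n → ∀ s′ → t →w[ m ] s′ → ¬ RNF s′)

  -- one unfolding of the parallel closure of Q
  ParStep : Rel → Rel → Rel
  ParStep Q P s t =
      Q s t
    ⊎ (Σ Term λ a → Atom a × s ≈ a × t ≈ a)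
    ⊎ (Σ Term λ s₁ → Σ Term λ s₂ → Σ Term λ t₁ → Σ Term λ t₂ →
         s ≈ s₁ · s₂ × t ≈ t₁ · t₂ × P s₁ t₁ × P s₂ t₂)
    ⊎ (Σ Term λ s′ → Σ Term λ t′ → s ≈ ƛ s′ × t ≈ ƛ t′ × P s′ t′)

  Par : Rel → Term → Term → Set₁
  Par Q s t = Σ Rel λ P → (∀ a b → P a b → ParStep Q P a b) × P s t

  Sim : (Term → Set) → Term → Term → Set₁
  Sim U = Par (λ s t → U s × U t)

  record Meaningless (U : Term → Set) : Set₁ where
    field
      closure          : ∀ t s → U t → t →∞β s → U s
      substitution     : ∀ t s x → U t → U (t [ s / x ])
      overlapping      : ∀ s t → U (ƛ s) → U ((ƛ s) · t)
      root-activeness  : ∀ t → RootActive t → U t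
      indiscernibility : ∀ t s → U t → Sim U t s → U s

  record StronglyMeaningless (U : Term → Set) : Set₁ where
    field
      meaningless : Meaningless U
      expansion   : ∀ t s → U t → s →∞β t → U s

  R⊥ : (Term → Set) → Rel
  R⊥ U t w = U t × ¬ (t ≈ ‵ bot) × w ≈ ‵ bot

  Rβ⊥ : (Term → Set) → Rel
  Rβ⊥ U t w = Rβ t w ⊎ R⊥ U t w

  β⊥NF : (Term → Set) → Term → Set
  β⊥NF U = NormalForm (Rβ⊥ U)

  NStep : (Term → Set) → Rel → Rel
  NStep U Q t s =
      (U t × s ≈ ‵ bot)
    ⊎ (¬ U t × Crnf t s × Atom s)
    ⊎ (¬ U t × Σ Term λ u → Σ Term λ t₁ → Σ Term λ t₂ → Σ Term λ s₁ → Σ Term λ s₂ →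
         Crnf t u × u ≈ t₁ · t₂ × Q t₁ s₁ × Q t₂ s₂ × s ≈ s₁ · s₂)
    ⊎ (¬ U t × Σ Term λ u → Σ Term λ t′ → Σ Term λ s′ →
         Crnf t u × u ≈ ƛ t′ × Q t′ s′ × s ≈ ƛ s′)

  _⇝N[_]_ : Term → (Term → Set) → Term → Set₁
  t ⇝N[ U ] s = Σ Rel λ Q → (∀ a b → Q a b → NStep U Q a b) × Q t s

-- A β-redex of s would sit at a position where the corresponding subterm of t
-- has an application u₁ u₂ as crnf while u₁ ⇝N ƛ _, i.e. u₁ →*β ƛ _, against
-- root-normality.  A ⊥-redex z ∈ U of s comes from a subterm x ∉ U with x ⇝N z.
-- Put back, in z, every ⊥ produced from a subterm in U: the result r satisfies
-- z ∼U r (⊥ ∈ U as ⊥ is root-active) and x →∞β r (every other node of z is a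
-- crnf of a subterm of x).  Indiscernibility gives r ∈ U, expansion x ∈ U.
module Submission where

open import Defs
open import Data.List using (List; []; _∷_)
open import Data.Product using (Σ; _×_; _,_; proj₁; proj₂)
open import Data.Sum using (_⊎_; inj₁; inj₂)
open import Data.Empty using (⊥-elim)
open import Function using (case_of_)
open import Relation.Binary.PropositionalEquality using (_≡_; _≢_; refl; sym; trans)
open import Relation.Nullary using (¬_)

pattern ⊥-step inU t≈⊥ = inj₁ (inU , t≈⊥)
pattern atom-step ∉U crnf atom = inj₂ (inj₁ (∉U , crnf , atom))
pattern app-step ∉U u t₁ t₂ s₁ s₂ crnf u≈ q₁ q₂ s≈ =
  inj₂ (inj₂ (inj₁ (∉U , u , t₁ , t₂ , s₁ , s₂ , crnf , u≈ , q₁ , q₂ , s≈)))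
pattern lam-step ∉U u t′ s′ crnf u≈ q s≈ =
  inj₂ (inj₂ (inj₂ (∉U , u , t′ , s′ , crnf , u≈ , q , s≈)))

pattern ∞-atom atom red = inj₁ (atom , red)
pattern ∞-app t₁ t₂ t₁′ t₂′ t≈ red q₁ q₂ = inj₂ (inj₁ (t₁ , t₂ , t₁′ , t₂′ , t≈ , red , q₁ , q₂))
pattern ∞-lam r r′ t≈ red q = inj₂ (inj₂ (r , r′ , t≈ , red , q))

pattern par-root q = inj₁ q
pattern par-atom a atom s≈ t≈ = inj₂ (inj₁ (a , atom , s≈ , t≈))
pattern par-app s₁ s₂ t₁ t₂ s≈ t≈ p₁ p₂ = inj₂ (inj₂ (inj₁ (s₁ , s₂ , t₁ , t₂ , s≈ , t≈ , p₁ , p₂)))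
pattern par-lam s′ t′ s≈ t≈ p = inj₂ (inj₂ (inj₂ (s′ , t′ , s≈ , t≈ , p)))

pattern rnf-atom atom ≉⊥ = inj₁ (atom , ≉⊥)
pattern rnf-lam t′ t≈ = inj₂ (inj₁ (t′ , t≈))
pattern rnf-app t₁ t₂ t≈ ¬lam = inj₂ (inj₂ (t₁ , t₂ , t≈ , ¬lam))

module Terms (C : Set) (bot : C) where
  open Lam C bot

  private
    variable
      a a′ b b′ s t u : Term
      p : List Dir
      Q : Rel

  ≈-root : s ≈ t → s [] ≡ t []
  ≈-root e = e [] here

  ≈-roots : s ≈ t → s ≈ u → t [] ≡ u []
  ≈-roots e e′ = trans (sym (≈-root e)) (≈-root e′)

  Reach-≈ : s ≈ t → Reach s p → Reach t p
  Reach-≈ e here = here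
  Reach-≈ e (left x r) = left (trans (sym (≈-root e)) x) (Reach-≈ (λ q r′ → e (L ∷ q) (left x r′)) r)
  Reach-≈ e (right x r) = right (trans (sym (≈-root e)) x) (Reach-≈ (λ q r′ → e (R ∷ q) (right x r′)) r)
  Reach-≈ e (body x r) = body (trans (sym (≈-root e)) x) (Reach-≈ (λ q r′ → e (B ∷ q) (body x r′)) r)

  Reach-≈˘ : s ≈ t → Reach t p → Reach s p
  Reach-≈˘ e here = here
  Reach-≈˘ e (left x r) = left x′ (Reach-≈˘ (λ q r′ → e (L ∷ q) (left x′ r′)) r)
    where x′ = trans (≈-root e) x
  Reach-≈˘ e (right x r) = right x′ (Reach-≈˘ (λ q r′ → e (R ∷ q) (right x′ r′)) r)
    where x′ = trans (≈-root e) x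
  Reach-≈˘ e (body x r) = body x′ (Reach-≈˘ (λ q r′ → e (B ∷ q) (body x′ r′)) r)
    where x′ = trans (≈-root e) x

  ≈-refl : s ≈ s
  ≈-refl _ _ = refl

  ≈-sym : s ≈ t → t ≈ s
  ≈-sym e p r = sym (e p (Reach-≈˘ e r))

  ≈-trans : s ≈ t → t ≈ u → s ≈ u
  ≈-trans e e′ p r = trans (e p r) (e′ p (Reach-≈ e r))

  ·-injectiveˡ : a · b ≈ a′ · b′ → a ≈ a′
  ·-injectiveˡ e p r = e (L ∷ p) (left refl r)

  ·-injectiveʳ : a · b ≈ a′ · b′ → b ≈ b′
  ·-injectiveʳ e p r = e (R ∷ p) (right refl r)

  ƛ-injective : ƛ a ≈ ƛ a′ → a ≈ a′
  ƛ-injective e p r = e (B ∷ p) (body refl r)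

  η-leaf : ∀ {l} → t [] ≡ l → l ≢ app → l ≢ lam → t ≈ (λ _ → l)
  η-leaf eq _ _ [] here = eq
  η-leaf eq ≢app _ (L ∷ _) (left x _) = ⊥-elim (≢app (trans (sym eq) x))
  η-leaf eq ≢app _ (R ∷ _) (right x _) = ⊥-elim (≢app (trans (sym eq) x))
  η-leaf eq _ ≢lam (B ∷ _) (body x _) = ⊥-elim (≢lam (trans (sym eq) x))

  η-app : t [] ≡ app → t ≈ sub t L · sub t R
  η-app eq [] here = eq
  η-app eq (L ∷ _) _ = refl
  η-app eq (R ∷ _) _ = refl
  η-app eq (B ∷ _) (body x _) = case trans (sym eq) x of λ ()

  η-lam : t [] ≡ lam → t ≈ ƛ sub t B
  η-lam eq [] here = eq
  η-lam eq (L ∷ _) (left x _) = case trans (sym eq) x of λ ()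
  η-lam eq (R ∷ _) (right x _) = case trans (sym eq) x of λ ()
  η-lam eq (B ∷ _) _ = refl

  Atom-≈ : Atom t → s ≈ t → Atom s
  Atom-≈ (inj₁ (c , e)) e′ = inj₁ (c , ≈-trans e′ e)
  Atom-≈ (inj₂ (n , e)) e′ = inj₂ (n , ≈-trans e′ e)

  Atom-≉· : Atom t → ¬ t ≈ a · b
  Atom-≉· (inj₁ (_ , e)) e′ = case ≈-roots e e′ of λ ()
  Atom-≉· (inj₂ (_ , e)) e′ = case ≈-roots e e′ of λ ()

  Atom-≉ƛ : Atom t → ¬ t ≈ ƛ a
  Atom-≉ƛ (inj₁ (_ , e)) e′ = case ≈-roots e e′ of λ ()
  Atom-≉ƛ (inj₂ (_ , e)) e′ = case ≈-roots e e′ of λ ()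

  Star-≈ʳ : Star Q s t → t ≈ u → Star Q s u
  Star-≈ʳ (ε e) e′ = ε (≈-trans e e′)
  Star-≈ʳ (step ◅ steps) e′ = step ◅ Star-≈ʳ steps e′

  →β-≈ˡ : s ≈ t → t →β u → s →β u
  →β-≈ˡ e (root (a , b , e′ , e″)) = root (a , b , ≈-trans e e′ , e″)
  →β-≈ˡ e (appL e′ step e″) = appL (≈-trans e e′) step e″
  →β-≈ˡ e (appR e′ step e″) = appR (≈-trans e e′) step e″
  →β-≈ˡ e (lamC e′ step e″) = lamC (≈-trans e e′) step e″

  →*β-≈ˡ : s ≈ t → t →*β u → s →*β u
  →*β-≈ˡ e (ε e′) = ε (≈-trans e e′)
  →*β-≈ˡ e (step ◅ steps) = →β-≈ˡ e step ◅ steps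

  →w⇒→β : s →w t → s →β t
  →w⇒→β (root r) = root r
  →w⇒→β (appL e step e′) = appL e (→w⇒→β step) e′

  →w[]⇒→*β : ∀ {n} → s →w[ n ] t → s →*β t
  →w[]⇒→*β (ε e) = ε e
  →w[]⇒→*β (step ◅ steps) = →w⇒→β step ◅ →w[]⇒→*β steps

  Crnf⇒→*β : Crnf s t → s →*β t
  Crnf⇒→*β (_ , steps , _) = →w[]⇒→*β steps

  Crnf⇒RNF : Crnf s t → RNF t
  Crnf⇒RNF (_ , _ , rnf , _) = rnf

  RNF-app-head : RNF u → u ≈ a · b → ¬ Σ Term (λ r → a →*β ƛ r)
  RNF-app-head (rnf-atom atom _) e _ = Atom-≉· atom e
  RNF-app-head (rnf-lam _ e′) e _ = case ≈-roots e′ e of λ ()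
  RNF-app-head (rnf-app _ _ e′ ¬lam) e (r , red) =
    ¬lam (r , →*β-≈ˡ (·-injectiveˡ (≈-trans (≈-sym e′) e)) red)

  RNF-≉⊥ : RNF t → ¬ t ≈ ‵ bot
  RNF-≉⊥ (rnf-atom _ ≉⊥) = ≉⊥
  RNF-≉⊥ (rnf-lam _ e) e′ = case ≈-roots e e′ of λ ()
  RNF-≉⊥ (rnf-app _ _ e _) e′ = case ≈-roots e e′ of λ ()

  InfStep-≈ : (∀ {s t} → s ≈ t → Q s t) → s ≈ t → InfStep Q s t
  InfStep-≈ {t = t} ≈⊆Q e with t [] in eq
  ... | con c = ∞-atom (inj₁ (c , η-leaf eq (λ ()) (λ ()))) (ε e)
  ... | var n = ∞-atom (inj₂ (n , η-leaf eq (λ ()) (λ ()))) (ε e)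
  ... | app = ∞-app _ _ _ _ (η-app eq) (ε (η-app eq′))
                (≈⊆Q (λ q r → e (L ∷ q) (left eq′ r))) (≈⊆Q (λ q r → e (R ∷ q) (right eq′ r)))
    where eq′ = trans (≈-root e) eq
  ... | lam = ∞-lam _ _ (η-lam eq) (ε (η-lam eq′)) (≈⊆Q (λ q r → e (B ∷ q) (body eq′ r)))
    where eq′ = trans (≈-root e) eq

  ≈⇒→∞β : s ≈ t → s →∞β t
  ≈⇒→∞β e = _≈_ , (λ _ _ → InfStep-≈ (λ e′ → e′)) , e

  ⊥-→*β : ‵ bot →*β t → t ≈ ‵ bot
  ⊥-→*β (ε e) = ≈-sym e
  ⊥-→*β (root (_ , _ , e , _) ◅ _) = case ≈-root e of λ ()
  ⊥-→*β (appL e _ _ ◅ _) = case ≈-root e of λ ()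
  ⊥-→*β (appR e _ _ ◅ _) = case ≈-root e of λ ()
  ⊥-→*β (lamC e _ _ ◅ _) = case ≈-root e of λ ()

  ⊥-RootActive : RootActive (‵ bot)
  ⊥-RootActive (t′ , rnf , Q , post , q) with post _ _ q
  ... | ∞-atom _ red = RNF-≉⊥ rnf (⊥-→*β red)
  ... | ∞-app _ _ _ _ _ red _ _ = case ≈-root (⊥-→*β red) of λ ()
  ... | ∞-lam _ _ _ red _ = case ≈-root (⊥-→*β red) of λ ()

module Unfolding (C : Set) (bot : C) (U : Lam.Term C bot → Set)
                 (SM : Lam.StronglyMeaningless C bot U)
                 (Q : Lam.Rel C bot) (Q-post : ∀ a b → Q a b → Lam.NStep C bot U Q a b) where
  open Lam C bot
  open Terms C bot
  open StronglyMeaningless SM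
  open Meaningless meaningless

  private
    variable
      a b x y z : Term

  U-≈ : U a → a ≈ b → U b
  U-≈ Ua e = closure _ _ Ua (≈⇒→∞β e)

  U-⊥ : U (‵ bot)
  U-⊥ = root-activeness _ ⊥-RootActive

  -- The junk positions are chosen as in _·_ and ƛ_, so that η-app refl and
  -- η-lam refl unfold restore one level.
  restore : ∀ x y → NStep U Q x y → Term
  restore x y (⊥-step _ _) p = x p
  restore x y (atom-step _ _ _) p = y p
  restore x y (app-step _ _ _ _ _ _ _ _ _ _ _) [] = app
  restore x y (app-step _ _ t₁ _ s₁ _ _ _ q₁ _ _) (L ∷ p) = restore t₁ s₁ (Q-post t₁ s₁ q₁) p
  restore x y (app-step _ _ _ t₂ _ s₂ _ _ _ q₂ _) (R ∷ p) = restore t₂ s₂ (Q-post t₂ s₂ q₂) p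
  restore x y (app-step _ _ _ _ _ _ _ _ _ _ _) (B ∷ p) = app
  restore x y (lam-step _ _ _ _ _ _ _ _) [] = lam
  restore x y (lam-step _ _ t′ s′ _ _ q _) (B ∷ p) = restore t′ s′ (Q-post t′ s′ q) p
  restore x y (lam-step _ _ _ _ _ _ _ _) (L ∷ p) = lam
  restore x y (lam-step _ _ _ _ _ _ _ _) (R ∷ p) = lam

  RestoredFrom : Rel
  RestoredFrom x r = Σ Term λ y → Σ (NStep U Q x y) λ n → r ≈ restore x y n

  Restored : Rel
  Restored y r = Σ Term λ x → Σ (NStep U Q x y) λ n → r ≈ restore x y n

  ≈∪RestoredFrom : Rel
  ≈∪RestoredFrom x r = x ≈ r ⊎ RestoredFrom x r

  ≈∪RestoredFrom-InfStep : ∀ x r → ≈∪RestoredFrom x r → InfStep ≈∪RestoredFrom x r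
  ≈∪RestoredFrom-InfStep x r (inj₁ e) = InfStep-≈ inj₁ e
  ≈∪RestoredFrom-InfStep x r (inj₂ (y , ⊥-step _ _ , e)) = InfStep-≈ inj₁ (≈-sym e)
  ≈∪RestoredFrom-InfStep x r (inj₂ (y , atom-step _ crnf atom , e)) =
    ∞-atom (Atom-≈ atom e) (Star-≈ʳ (Crnf⇒→*β crnf) (≈-sym e))
  ≈∪RestoredFrom-InfStep x r (inj₂ (y , app-step _ _ t₁ t₂ s₁ s₂ crnf u≈ q₁ q₂ _ , e)) =
    ∞-app t₁ t₂ _ _ (≈-trans e (η-app refl)) (Star-≈ʳ (Crnf⇒→*β crnf) u≈)
      (inj₂ (s₁ , Q-post t₁ s₁ q₁ , ≈-refl)) (inj₂ (s₂ , Q-post t₂ s₂ q₂ , ≈-refl))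
  ≈∪RestoredFrom-InfStep x r (inj₂ (y , lam-step _ _ t′ s′ crnf u≈ q _ , e)) =
    ∞-lam t′ _ (≈-trans e (η-lam refl)) (Star-≈ʳ (Crnf⇒→*β crnf) u≈)
      (inj₂ (s′ , Q-post t′ s′ q , ≈-refl))

  →∞β-restore : (n : NStep U Q x y) → x →∞β restore x y n
  →∞β-restore n = ≈∪RestoredFrom , ≈∪RestoredFrom-InfStep , inj₂ (_ , n , ≈-refl)

  Restored-ParStep : ∀ y r → Restored y r → ParStep (λ a b → U a × U b) Restored y r
  Restored-ParStep y r (x , ⊥-step Ux y≈⊥ , e) = par-root (U-≈ U-⊥ (≈-sym y≈⊥) , U-≈ Ux (≈-sym e))
  Restored-ParStep y r (x , atom-step _ _ atom , e) = par-atom y atom ≈-refl e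
  Restored-ParStep y r (x , app-step _ _ t₁ t₂ s₁ s₂ _ _ q₁ q₂ y≈ , e) =
    par-app s₁ s₂ _ _ y≈ (≈-trans e (η-app refl))
      (t₁ , Q-post t₁ s₁ q₁ , ≈-refl) (t₂ , Q-post t₂ s₂ q₂ , ≈-refl)
  Restored-ParStep y r (x , lam-step _ _ t′ s′ _ _ q y≈ , e) =
    par-lam s′ _ y≈ (≈-trans e (η-lam refl)) (t′ , Q-post t′ s′ q , ≈-refl)

  ∼U-restore : (n : NStep U Q x y) → Sim U y (restore x y n)
  ∼U-restore n = Restored , Restored-ParStep , (_ , n , ≈-refl)

  U-reflect : NStep U Q x y → U y → U x
  U-reflect n Uy = expansion _ _ (indiscernibility _ _ Uy (∼U-restore n)) (→∞β-restore n)

  NStep-U : NStep U Q x y → U x → y ≈ ‵ bot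
  NStep-U (⊥-step _ y≈⊥) _ = y≈⊥
  NStep-U (atom-step ∉U _ _) Ux = ⊥-elim (∉U Ux)
  NStep-U (app-step ∉U _ _ _ _ _ _ _ _ _ _) Ux = ⊥-elim (∉U Ux)
  NStep-U (lam-step ∉U _ _ _ _ _ _ _) Ux = ⊥-elim (∉U Ux)

  NStep-ƛ-→*β : NStep U Q x y → y ≈ ƛ a → Σ Term λ r → x →*β ƛ r
  NStep-ƛ-→*β (⊥-step _ y≈⊥) e = case ≈-roots y≈⊥ e of λ ()
  NStep-ƛ-→*β (atom-step _ _ atom) e = ⊥-elim (Atom-≉ƛ atom e)
  NStep-ƛ-→*β (app-step _ _ _ _ _ _ _ _ _ _ y≈) e = case ≈-roots y≈ e of λ ()
  NStep-ƛ-→*β (lam-step _ _ t′ _ crnf u≈ _ _) _ = t′ , Star-≈ʳ (Crnf⇒→*β crnf) u≈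

  Produced : Term → Set
  Produced z = Σ Term λ x → Σ Term λ y → NStep U Q x y × y ≈ z

  Produced-≈ : Produced a → a ≈ b → Produced b
  Produced-≈ (x , y , n , e) e′ = x , y , n , ≈-trans e e′

  Produced-· : Produced (a · b) → Produced a × Produced b
  Produced-· (_ , _ , ⊥-step _ y≈⊥ , e) = case ≈-roots y≈⊥ e of λ ()
  Produced-· (_ , _ , atom-step _ _ atom , e) = ⊥-elim (Atom-≉· atom e)
  Produced-· (_ , _ , app-step _ _ t₁ t₂ s₁ s₂ _ _ q₁ q₂ y≈ , e) =
    (t₁ , s₁ , Q-post t₁ s₁ q₁ , ·-injectiveˡ s₁s₂≈) , (t₂ , s₂ , Q-post t₂ s₂ q₂ , ·-injectiveʳ s₁s₂≈)
    where s₁s₂≈ = ≈-trans (≈-sym y≈) e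
  Produced-· (_ , _ , lam-step _ _ _ _ _ _ _ y≈ , e) = case ≈-roots y≈ e of λ ()

  Produced-ƛ : Produced (ƛ a) → Produced a
  Produced-ƛ (_ , _ , ⊥-step _ y≈⊥ , e) = case ≈-roots y≈⊥ e of λ ()
  Produced-ƛ (_ , _ , atom-step _ _ atom , e) = ⊥-elim (Atom-≉ƛ atom e)
  Produced-ƛ (_ , _ , app-step _ _ _ _ _ _ _ _ _ _ y≈ , e) = case ≈-roots y≈ e of λ ()
  Produced-ƛ (_ , _ , lam-step _ _ t′ s′ _ _ q y≈ , e) =
    t′ , s′ , Q-post t′ s′ q , ƛ-injective (≈-trans (≈-sym y≈) e)

  Produced-¬β-redex : ¬ Produced ((ƛ a) · b)
  Produced-¬β-redex (_ , _ , ⊥-step _ y≈⊥ , e) = case ≈-roots y≈⊥ e of λ ()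
  Produced-¬β-redex (_ , _ , atom-step _ _ atom , e) = Atom-≉· atom e
  Produced-¬β-redex (_ , _ , app-step _ _ t₁ _ s₁ _ crnf u≈ q₁ _ y≈ , e) =
    RNF-app-head (Crnf⇒RNF crnf) u≈
      (NStep-ƛ-→*β (Q-post t₁ s₁ q₁) (·-injectiveˡ (≈-trans (≈-sym y≈) e)))
  Produced-¬β-redex (_ , _ , lam-step _ _ _ _ _ _ _ y≈ , e) = case ≈-roots y≈ e of λ ()

  Produced-U : Produced z → U z → z ≈ ‵ bot
  Produced-U (_ , _ , n , y≈z) Uz = ≈-trans (≈-sym y≈z) (NStep-U n (U-reflect n (U-≈ Uz (≈-sym y≈z))))

  Produced-β⊥NF : Produced z → β⊥NF U z
  Produced-β⊥NF P _ (root (inj₁ (_ , _ , e , _))) = Produced-¬β-redex (Produced-≈ P e)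
  Produced-β⊥NF P _ (root (inj₂ (Uz , ≉⊥ , _))) = ≉⊥ (Produced-U P Uz)
  Produced-β⊥NF P _ (appL e step _) = Produced-β⊥NF (proj₁ (Produced-· (Produced-≈ P e))) _ step
  Produced-β⊥NF P _ (appR e step _) = Produced-β⊥NF (proj₂ (Produced-· (Produced-≈ P e))) _ step
  Produced-β⊥NF P _ (lamC e step _) = Produced-β⊥NF (Produced-ƛ (Produced-≈ P e)) _ step

lemma5p30 : (C : Set) (bot : C) → let open Lam C bot in
    (U : Term → Set) → StronglyMeaningless U →
    ∀ t s → t ⇝N[ U ] s → β⊥NF U s
lemma5p30 C bot U SM t s (Q , Q-post , q) =
  Unfolding.Produced-β⊥NF C bot U SM Q Q-post (t , s , Q-post t s q , Terms.≈-refl C bot)
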